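{- Let $n\ge 3$ and let $M$ be the $(n+2)\times(n+3)$ $0,1$ matrix defined as follows (rows indexed $1,\dots,n+2$, columns $1,\dots,n+3$). For $1\le i\le n$, row $i$ has $M_{i,i}=1$ and $M_{i,j}=0$ for all $j\le n$, $j\neq i$; its entries in columns $n+1,n+2,n+3$ are $(0,1,1)$ if $i=1$, $(1,0,1)$ if $i=2$, $(1,1,0)$ if $i=3$, and $(1,1,1)$ if $4\le i\le n$. Row $n+1$ has zeros in columns $1,\dots,n$ and ones in columns $n+1,n+2,n+3$. Row $n+2$ consists entirely of ones. Then $\mathrm{rank}_{\mathrm{bin}}(M) = n+2$, whereas every $(n+2)\times(n+2)$ sub-matrix of $M$ (obtained by deleting one column) has binary rank at most $n+1$.
   Context: The binary rank $\mathrm{rank}_{\mathrm{bin}}(M)$ of a $0,1$ matrix $M$ of size $p\times q$ is the minimal $d$ with $M=A\cdot B$, $A$ a $0,1$ matrix of size $p\times d$, $B$ a $0,1$ matrix of size $d\times q$, product computed over the integers; equivalently, the minimum number of pairwise disjoint all-ones submatrices (rows and columns not necessarily consecutive) partitioning the $1$-entries of $M$. -}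

module Defs where

open import Data.Bool using (Bool; true; false; if_then_else_; not; _∧_)
open import Data.Nat using (ℕ; zero; suc; _+_; _*_; _∸_; _≤_; _<ᵇ_; _≡ᵇ_)
open import Data.Fin using (Fin; toℕ; punchIn)
import Data.Fin as F
open import Data.Product using (Σ; _×_; _,_)
open import Relation.Binary.PropositionalEquality using (_≡_)

Mat01 : ℕ → ℕ → Set
Mat01 p q = Fin p → Fin q → Bool

val : Bool → ℕ
val true  = 1
val false = 0

sumFin : (d : ℕ) → (Fin d → ℕ) → ℕ
sumFin zero    f = 0
sumFin (suc d) f = f F.zero + sumFin d (λ k → f (F.suc k))

BinFactorization : {p q : ℕ} → Mat01 p q → (d : ℕ) → Set
BinFactorization {p} {q} M d =
  Σ (Mat01 p d) λ A → Σ (Mat01 d q) λ B →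
    ∀ (i : Fin p) (j : Fin q) →
      val (M i j) ≡ sumFin d (λ k → val (A i k) * val (B k j))

IsBinRank : {p q : ℕ} → Mat01 p q → ℕ → Set
IsBinRank M r = BinFactorization M r × (∀ d → BinFactorization M d → r ≤ d)

BinRankAtMost : {p q : ℕ} → Mat01 p q → ℕ → Set
BinRankAtMost M r = Σ ℕ λ d → d ≤ r × BinFactorization M d

deleteCol : {p q : ℕ} → Mat01 p (suc q) → Fin (suc q) → Mat01 p q
deleteCol M c i j = M i (punchIn c j)

-- The matrix of the theorem, 0-based: rows 0..n+1, columns 0..n+2 (suc (n + 2) = n+3 columns).
-- Paper row i (1 ≤ i ≤ n) is row i-1 here; paper columns n+1,n+2,n+3 are n,n+1,n+2.
-- For a row r < n: entry at column c < n is [r = c]; at column c ≥ n it is 0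
-- iff c - n = r (so rows 0,1,2 get (0,1,1),(1,0,1),(1,1,0), rows ≥ 3 get (1,1,1)).
entry : ℕ → ℕ → ℕ → Bool
entry n r c =
  if r <ᵇ n
  then (if c <ᵇ n then (r ≡ᵇ c) else not ((c ∸ n) ≡ᵇ r))
  else (if r ≡ᵇ n then not (c <ᵇ n) else true)

Mthm : (n : ℕ) → Mat01 (n + 2) (suc (n + 2))
Mthm n i j = entry n (toℕ i) (toℕ j)

{-# OPTIONS --safe #-}
-- Indices are 0-based, as in the definition of Mthm.
--
-- In a partition of the ones of M into all-ones rectangles, the rectangles R j
-- through the diagonal entries (j, j), j < n, are pairwise distinct, and for j ≤ 1 the
-- rectangle through (n, n + j) is none of them, row n being zero on the first n columns.
-- A rectangle through (n + 1, j) or through (j, n + 2) other than R j is yet another one,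
-- because of the zeros at (j′, j), (j, j′), (n, j) and (j, n + j).  So with only n + 1
-- rectangles, the distinct rectangles R 0 and R 1 would both contain (n + 1, n + 2).
--
-- For a < 3 let b, c be the other two elements of {0, 1, 2}.  The rectangles
-- {k, n + 1} × {k} for k < n, k ∉ {b, c}, together with
--   {b, n + 1} × {b, n + c},   {c, n + 1} × {c, n + a, n + b},
--   X = ({n} ∪ {r < n ∣ r ∉ {a, c}}) × {n + a},
--   Y = ({n} ∪ {r < n ∣ r ∉ {b, c}}) × {n + b, n + c}
-- partition the ones of M.  Column a, column n + a and every column j with 3 ≤ j < n is the
-- whole column set of one of these rectangles, so deleting it leaves n + 1 rectangles; every
-- column is of this kind for a suitable a.
module Submission where

open import Defs
open import Data.Nat using (ℕ; suc; _≤_; _+_)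
open import Data.Fin using (Fin)
open import Data.Product using (_×_)

open import Data.Bool using (Bool; true; false; not; if_then_else_; _∨_)
open import Data.Fin using (zero; suc; toℕ; fromℕ<; punchIn; punchOut)
open import Data.Fin.Patterns using (0F; 1F; 2F)
open import Data.Fin.Properties
  using (toℕ<n; toℕ-fromℕ<; toℕ-injective; punchIn-punchOut; punchInᵢ≢i; injective⇒≤; all?)
  renaming (_≟_ to _≟ᶠ_)
open import Data.Nat using (zero; _*_; _∸_; _<_; _<ᵇ_; _≡ᵇ_; z≤n; z<s; s≤s; s≤s⁻¹)
open import Data.Nat.Properties
open import Algebra.Properties.CommutativeMonoid.Sum +-0-commutativeMonoid using (sum; sum-remove)
open import Data.Product using (∃; _,_; proj₁; proj₂)
open import Data.Sum using (_⊎_; inj₁; inj₂)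
open import Data.Vec.Functional using (_∷_)
open import Function using (_∘_)
open import Function.Definitions using (Injective)
open import Relation.Binary.Definitions using (tri<; tri≈; tri>)
open import Relation.Binary.PropositionalEquality
open import Relation.Nullary using (¬_; Dec; yes; no; contradiction)
open import Relation.Nullary.Decidable using (dec-true; dec-false; from-yes)

<ᵇ-true : ∀ {m n} → m < n → (m <ᵇ n) ≡ true
<ᵇ-true {m} {n} = dec-true (m <? n)

<ᵇ-false : ∀ {m n} → n ≤ m → (m <ᵇ n) ≡ false
<ᵇ-false {m} {n} n≤m = dec-false (m <? n) (≤⇒≯ n≤m)

≡ᵇ-refl : ∀ n → (n ≡ᵇ n) ≡ true
≡ᵇ-refl n = dec-true (n ≟ n) refl

≡ᵇ-false : ∀ {m n} → m ≢ n → (m ≡ᵇ n) ≡ false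
≡ᵇ-false {m} {n} = dec-false (m ≟ n)

val≤1 : ∀ b → val b ≤ 1
val≤1 true  = ≤-refl
val≤1 false = z≤n

val+val-not : ∀ b → val b + val (not b) ≡ 1
val+val-not true  = refl
val+val-not false = refl

val*val-positive : ∀ {a b} → 0 < val a * val b → a ≡ true × b ≡ true
val*val-positive {true} {true} _ = refl , refl

sumFin≡sum : ∀ d (f : Fin d → ℕ) → sumFin d f ≡ sum f
sumFin≡sum zero    f = refl
sumFin≡sum (suc d) f = cong (f zero +_) (sumFin≡sum d (f ∘ suc))

sumFin-punchIn : ∀ d (f : Fin (suc d) → ℕ) k → sumFin (suc d) f ≡ f k + sumFin d (f ∘ punchIn k)
sumFin-punchIn d f k = begin
  sumFin (suc d) f               ≡⟨ sumFin≡sum (suc d) f ⟩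
  sum f                          ≡⟨ sum-remove f ⟩
  f k + sum (f ∘ punchIn k)      ≡⟨ cong (f k +_) (sumFin≡sum d (f ∘ punchIn k)) ⟨
  f k + sumFin d (f ∘ punchIn k) ∎
  where open ≡-Reasoning

term≤sumFin : ∀ d (f : Fin d → ℕ) k → f k ≤ sumFin d f
term≤sumFin (suc d) f k = subst (f k ≤_) (sym (sumFin-punchIn d f k)) (m≤m+n (f k) _)

terms≤sumFin : ∀ d (f : Fin d → ℕ) {k k′} → k ≢ k′ → f k + f k′ ≤ sumFin d f
terms≤sumFin (suc d) f {k} {k′} k≢k′ = begin
  f k + f k′                              ≡⟨ cong (λ l → f k + f l) (punchIn-punchOut k≢k′) ⟨
  f k + f (punchIn k (punchOut k≢k′))     ≤⟨ +-monoʳ-≤ (f k) (term≤sumFin d (f ∘ punchIn k) _) ⟩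
  f k + sumFin d (f ∘ punchIn k)          ≡⟨ sumFin-punchIn d f k ⟨
  sumFin (suc d) f                        ∎
  where open ≤-Reasoning

sumFin-positive : ∀ d (f : Fin d → ℕ) → 0 < sumFin d f → ∃ λ k → 0 < f k
sumFin-positive (suc d) f pos with f zero in f₀
... | suc _ = zero , subst (0 <_) (sym f₀) z<s
... | zero  = let k , fk>0 = sumFin-positive d (f ∘ suc) pos in suc k , fk>0

sumTo : ℕ → (ℕ → ℕ) → ℕ
sumTo zero    g = 0
sumTo (suc d) g = sumTo d g + g d

sumTo-suc : ∀ d g → sumTo (suc d) g ≡ g 0 + sumTo d (g ∘ suc)
sumTo-suc zero    g = sym (+-identityʳ (g 0))
sumTo-suc (suc d) g = trans (cong (_+ g (suc d)) (sumTo-suc d g)) (+-assoc (g 0) _ _)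

sumFin-toℕ : ∀ d g → sumFin d (g ∘ toℕ) ≡ sumTo d g
sumFin-toℕ zero    g = refl
sumFin-toℕ (suc d) g = trans (cong (g 0 +_) (sumFin-toℕ d (g ∘ suc))) (sym (sumTo-suc d g))

sumTo-cong : ∀ d {g h} → (∀ {k} → k < d → g k ≡ h k) → sumTo d g ≡ sumTo d h
sumTo-cong zero    g≗h = refl
sumTo-cong (suc d) g≗h = cong₂ _+_ (sumTo-cong d (λ k<d → g≗h (m<n⇒m<1+n k<d))) (g≗h ≤-refl)

sumTo-zero : ∀ d {g} → (∀ {k} → k < d → g k ≡ 0) → sumTo d g ≡ 0
sumTo-zero zero    g≡0 = refl
sumTo-zero (suc d) g≡0 = cong₂ _+_ (sumTo-zero d (λ k<d → g≡0 (m<n⇒m<1+n k<d))) (g≡0 ≤-refl)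

sumTo-single : ∀ {d g m} → m < d → (∀ {k} → k < d → k ≢ m → g k ≡ 0) → sumTo d g ≡ g m
sumTo-single {suc d} {g} {m} m<1+d g≡0 with m ≟ d
... | yes refl = cong (_+ g m) (sumTo-zero d (λ k<d → g≡0 (m<n⇒m<1+n k<d) (<⇒≢ k<d)))
... | no m≢d   = trans
  (cong₂ _+_ (sumTo-single (≤∧≢⇒< (s≤s⁻¹ m<1+d) m≢d) (λ k<d → g≡0 (m<n⇒m<1+n k<d)))
             (g≡0 ≤-refl (≢-sym m≢d)))
  (+-identityʳ (g m))

sumTo-δˡ : ∀ {d m} (f : ℕ → ℕ) → m < d → sumTo d (λ k → val (m ≡ᵇ k) * f k) ≡ f m
sumTo-δˡ {m = m} f m<d = trans
  (sumTo-single {g = λ k → val (m ≡ᵇ k) * f k} m<d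
    (λ {k} _ k≢m → cong (λ b → val b * f k) (≡ᵇ-false (≢-sym k≢m))))
  (trans (cong (λ b → val b * f m) (≡ᵇ-refl m)) (*-identityˡ (f m)))

sumTo-δʳ : ∀ {d m} (f : ℕ → ℕ) → m < d → sumTo d (λ k → f k * val (k ≡ᵇ m)) ≡ f m
sumTo-δʳ {m = m} f m<d = trans
  (sumTo-single {g = λ k → f k * val (k ≡ᵇ m)} m<d
    (λ {k} _ k≢m → trans (cong (λ b → f k * val b) (≡ᵇ-false k≢m)) (*-zeroʳ (f k))))
  (trans (cong (λ b → f m * val b) (≡ᵇ-refl m)) (*-identityʳ (f m)))

module Covering {p q d} {M : Mat01 p q} (F : BinFactorization M d) where

  private
    A = proj₁ F
    B = proj₁ (proj₂ F)
    M≡AB = proj₂ (proj₂ F)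

    hits : Fin p → Fin q → Fin d → ℕ
    hits i j k = val (A i k) * val (B k j)

  Covers : Fin d → Fin p → Fin q → Set
  Covers k i j = A i k ≡ true × B k j ≡ true

  private
    hits-covered : ∀ {i j k} → Covers k i j → hits i j k ≡ 1
    hits-covered (Aik , Bkj) rewrite Aik | Bkj = refl

  covered : ∀ {i j} → M i j ≡ true → ∃ λ k → Covers k i j
  covered {i} {j} Mij =
    let k , hit = sumFin-positive d (hits i j) (subst (0 <_) (trans (cong val (sym Mij)) (M≡AB i j)) z<s)
    in k , val*val-positive hit

  uncovered : ∀ {i j k} → M i j ≡ false → ¬ Covers k i j
  uncovered {i} {j} {k} Mij k-covers with () ←
    subst₂ _≤_ (hits-covered k-covers) (trans (sym (M≡AB i j)) (cong val Mij))
               (term≤sumFin d (hits i j) k)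

  covers-unique : ∀ {i j k k′} → Covers k i j → Covers k′ i j → k ≡ k′
  covers-unique {i} {j} {k} {k′} k-covers k′-covers with k ≟ᶠ k′
  ... | yes k≡k′ = k≡k′
  ... | no k≢k′  = contradiction (≤-trans two≤M (val≤1 (M i j))) λ { (s≤s ()) }
    where
    two≤M : 2 ≤ val (M i j)
    two≤M = subst₂ _≤_ (cong₂ _+_ (hits-covered k-covers) (hits-covered k′-covers)) (sym (M≡AB i j))
                   (terms≤sumFin d (hits i j) k≢k′)

  covers-rectangle : ∀ {i j i′ j′ k} → Covers k i j → Covers k i′ j′ → Covers k i j′
  covers-rectangle (Aik , _) (_ , Bkj′) = Aik , Bkj′

  covers-apart : ∀ {i j i′ j′ k k′} → Covers k i j → Covers k′ i′ j′ → M i j′ ≡ false → k ≢ k′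
  covers-apart k-covers k′-covers Mij′ refl = uncovered Mij′ (covers-rectangle k-covers k′-covers)

deleteCol-factorization : ∀ {p q d} {M : Mat01 p (suc q)} {c} (F : BinFactorization M (suc d)) k₀ →
  (∀ j → j ≢ c → proj₁ (proj₂ F) k₀ j ≡ false) → BinFactorization (deleteCol M c) d
deleteCol-factorization {d = d} {M} {c} (A , B , M≡AB) k₀ k₀⊆c =
  (λ i l → A i (punchIn k₀ l)) , (λ l j → B (punchIn k₀ l) (punchIn c j)) , M′≡A′B′
  where
  M′≡A′B′ : ∀ i j →
    val (M i (punchIn c j)) ≡ sumFin d (λ l → val (A i (punchIn k₀ l)) * val (B (punchIn k₀ l) (punchIn c j)))
  M′≡A′B′ i j = begin
    val (M i (punchIn c j))
      ≡⟨ M≡AB i (punchIn c j) ⟩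
    sumFin (suc d) (λ k → val (A i k) * val (B k (punchIn c j)))
      ≡⟨ sumFin-punchIn d (λ k → val (A i k) * val (B k (punchIn c j))) k₀ ⟩
    val (A i k₀) * val (B k₀ (punchIn c j)) + rest
      ≡⟨ cong (λ b → val (A i k₀) * val b + rest) (k₀⊆c (punchIn c j) (punchInᵢ≢i c j)) ⟩
    val (A i k₀) * 0 + rest
      ≡⟨ cong (_+ rest) (*-zeroʳ (val (A i k₀))) ⟩
    rest ∎
    where
    open ≡-Reasoning
    rest = sumFin d (λ l → val (A i (punchIn k₀ l)) * val (B (punchIn k₀ l) (punchIn c j)))

injective-∷ : ∀ {m d} {x : Fin d} {f : Fin m → Fin d} →
  Injective _≡_ _≡_ f → (∀ j → x ≢ f j) → Injective _≡_ _≡_ (x ∷ f)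
injective-∷ f-inj x∉f {zero}  {zero}  _  = refl
injective-∷ f-inj x∉f {zero}  {suc j} eq = contradiction eq (x∉f j)
injective-∷ f-inj x∉f {suc i} {zero}  eq = contradiction (sym eq) (x∉f i)
injective-∷ f-inj x∉f {suc i} {suc j} eq = cong suc (f-inj eq)

module RankLowerBound {p q n} (M : Mat01 p q)
  (row : Fin n → Fin p) (col : Fin n → Fin q) (mid top : Fin p) (σ : Fin q)
  (diag-one  : ∀ j → M (row j) (col j) ≡ true)
  (diag-zero : ∀ {j j′} → j ≢ j′ → M (row j) (col j′) ≡ false)
  (mid-zero  : ∀ j → M mid (col j) ≡ false)
  (top-one   : ∀ j → M top (col j) ≡ true)
  where

  record Escape (j : Fin n) : Set where
    field
      θ     : Fin q
      mid-θ : M mid θ ≡ true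
      row-θ : M (row j) θ ≡ false
      row-σ : M (row j) σ ≡ true

  open Escape

  module _ {d} (F : BinFactorization M d) where
    open Covering F

    R : Fin n → Fin d
    R j = proj₁ (covered (diag-one j))

    R-covers : ∀ j → Covers (R j) (row j) (col j)
    R-covers j = proj₂ (covered (diag-one j))

    R-injective : Injective _≡_ _≡_ R
    R-injective {j} {j′} Rj≡Rj′ with j ≟ᶠ j′
    ... | yes j≡j′ = j≡j′
    ... | no j≢j′  = contradiction Rj≡Rj′ (covers-apart (R-covers j) (R-covers j′) (diag-zero j≢j′))

    Fresh : Fin d → Set
    Fresh k = ∀ j → k ≢ R j

    two-fresh : ∀ {x y} → Fresh x → Fresh y → y ≢ x → suc (suc n) ≤ d
    two-fresh x-fresh y-fresh y≢x =
      injective⇒≤ (injective-∷ (injective-∷ R-injective x-fresh) λ { zero → y≢x ; (suc j) → y-fresh j })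

    Z : ∀ {j} → Escape j → Fin d
    Z e = proj₁ (covered (mid-θ e))

    Z-covers : ∀ {j} (e : Escape j) → Covers (Z e) mid (θ e)
    Z-covers e = proj₂ (covered (mid-θ e))

    Z-fresh : ∀ {j} (e : Escape j) → Fresh (Z e)
    Z-fresh e j = covers-apart (Z-covers e) (R-covers j) (mid-zero j)

    fresh-or-covers : ∀ {j} (e : Escape j) → (∃ λ E → Fresh E × E ≢ Z e) ⊎ Covers (R j) top σ
    fresh-or-covers {j} e with covered (top-one j) | covered (row-σ e)
    ... | X , X-covers | Y , Y-covers with X ≟ᶠ R j | Y ≟ᶠ R j
    ... | no X≢Rj | _ = inj₁ (X , X-fresh , ≢-sym (covers-apart (Z-covers e) X-covers (mid-zero j)))
      where
      X-fresh : Fresh X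
      X-fresh j′ with j′ ≟ᶠ j
      ... | yes refl = X≢Rj
      ... | no j′≢j  = ≢-sym (covers-apart (R-covers j′) X-covers (diag-zero j′≢j))
    ... | yes refl | no Y≢Rj = inj₁ (Y , Y-fresh , covers-apart Y-covers (Z-covers e) (row-θ e))
      where
      Y-fresh : Fresh Y
      Y-fresh j′ with j′ ≟ᶠ j
      ... | yes refl = Y≢Rj
      ... | no j′≢j  = covers-apart Y-covers (R-covers j′) (diag-zero (≢-sym j′≢j))
    ... | yes refl | yes refl = inj₂ (covers-rectangle X-covers Y-covers)

    rank≥ : ∀ {j₀ j₁} → j₀ ≢ j₁ → Escape j₀ → Escape j₁ → suc (suc n) ≤ d
    rank≥ j₀≢j₁ e₀ e₁ with fresh-or-covers e₀ | fresh-or-covers e₁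
    ... | inj₁ (E , E-fresh , E≢Z) | _ = two-fresh (Z-fresh e₀) E-fresh E≢Z
    ... | inj₂ _ | inj₁ (E , E-fresh , E≢Z) = two-fresh (Z-fresh e₁) E-fresh E≢Z
    ... | inj₂ R₀-covers | inj₂ R₁-covers =
      contradiction (R-injective (covers-unique R₀-covers R₁-covers)) j₀≢j₁

data RowPart : Set where
  low     : ℕ → RowPart
  mid top : RowPart

data ColPart : Set where
  low tail : ℕ → ColPart

rowPart : ℕ → ℕ → RowPart
rowPart n r = if r <ᵇ n then low r else (if r ≡ᵇ n then mid else top)

colPart : ℕ → ℕ → ColPart
colPart n c = if c <ᵇ n then low c else tail (c ∸ n)

entryᵖ : RowPart → ColPart → Bool
entryᵖ (low r) (low c)  = r ≡ᵇ c
entryᵖ (low r) (tail t) = not (t ≡ᵇ r)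
entryᵖ mid     (low _)  = false
entryᵖ mid     (tail _) = true
entryᵖ top     _        = true

entry-parts : ∀ n r c → entry n r c ≡ entryᵖ (rowPart n r) (colPart n c)
entry-parts n r c with r <ᵇ n | c <ᵇ n | r ≡ᵇ n
... | true  | true  | _     = refl
... | true  | false | _     = refl
... | false | true  | true  = refl
... | false | false | true  = refl
... | false | _     | false = refl

rowPart-low : ∀ {n r} → r < n → rowPart n r ≡ low r
rowPart-low r<n rewrite <ᵇ-true r<n = refl

rowPart-mid : ∀ n → rowPart n n ≡ mid
rowPart-mid n rewrite <ᵇ-false (≤-refl {n}) | ≡ᵇ-refl n = refl

rowPart-top : ∀ n → rowPart n (suc n) ≡ top
rowPart-top n rewrite <ᵇ-false (n≤1+n n) | ≡ᵇ-false (1+n≢n {n}) = refl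

colPart-low : ∀ {n c} → c < n → colPart n c ≡ low c
colPart-low c<n rewrite <ᵇ-true c<n = refl

colPart-high : ∀ {n c} → n ≤ c → colPart n c ≡ tail (c ∸ n)
colPart-high n≤c rewrite <ᵇ-false n≤c = refl

colPart-tail : ∀ n t → colPart n (n + t) ≡ tail t
colPart-tail n t = trans (colPart-high (m≤m+n n t)) (cong tail (m+n∸m≡n n t))

colPart-injective : ∀ {n c c′} → colPart n c ≡ colPart n c′ → c ≡ c′
colPart-injective {n} {c} {c′} eq = begin
  c                        ≡⟨ unPart-colPart c ⟨
  unPart (colPart n c)     ≡⟨ cong unPart eq ⟩
  unPart (colPart n c′)    ≡⟨ unPart-colPart c′ ⟩
  c′                       ∎
  where
  open ≡-Reasoning
  unPart : ColPart → ℕ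
  unPart (low c)  = c
  unPart (tail t) = n + t
  unPart-colPart : ∀ c → unPart (colPart n c) ≡ c
  unPart-colPart c with c <? n
  ... | yes c<n = cong unPart (colPart-low c<n)
  ... | no c≮n  = trans (cong unPart (colPart-high (≮⇒≥ c≮n))) (m+[n∸m]≡n (≮⇒≥ c≮n))

data RowView (n : ℕ) : RowPart → Set where
  low : ∀ {r} → r < n → RowView n (low r)
  mid : RowView n mid
  top : RowView n top

data ColView (n : ℕ) : ColPart → Set where
  low  : ∀ {c} → c < n → ColView n (low c)
  tail : ∀ {t} → t < 3 → ColView n (tail t)

rowView : ∀ {n r} → r < n + 2 → RowView n (rowPart n r)
rowView {n} {r} r<n+2 with <-cmp r n
... | tri< r<n _ _ = subst (RowView n) (sym (rowPart-low r<n)) (low r<n)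
... | tri≈ _ refl _ = subst (RowView n) (sym (rowPart-mid n)) mid
... | tri> _ _ n<r rewrite ≤-antisym (s≤s⁻¹ (subst (r <_) (+-comm n 2) r<n+2)) n<r =
  subst (RowView n) (sym (rowPart-top n)) top

colView : ∀ {n c} → c < suc (n + 2) → ColView n (colPart n c)
colView {n} {c} c<n+3 with c <? n
... | yes c<n = subst (ColView n) (sym (colPart-low c<n)) (low c<n)
... | no c≮n  = subst (ColView n) (sym (colPart-high (≮⇒≥ c≮n)))
                      (tail (m<n+o⇒m∸n<o c n (subst (c <_) (sym (+-suc n 2)) c<n+3)))

sumTo-rowParts : ∀ n (h : RowPart → ℕ) →
  sumTo (suc (suc n)) (h ∘ rowPart n) ≡ sumTo n (h ∘ low) + h mid + h top
sumTo-rowParts n h = cong₂ _+_ (cong₂ _+_ (sumTo-cong n (cong h ∘ rowPart-low)) (cong h (rowPart-mid n)))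
                               (cong h (rowPart-top n))

low<rows : ∀ {n r} → r < n → r < n + 2
low<rows = m≤n⇒m≤n+o 2

mid<rows : ∀ n → n < n + 2
mid<rows n = m<m+n n z<s

top<rows : ∀ n → suc n < n + 2
top<rows n = subst (suc n <_) (+-comm 2 n) ≤-refl

low<cols : ∀ {n c} → c < n → c < suc (n + 2)
low<cols c<n = m<n⇒m<1+n (low<rows c<n)

tail<cols : ∀ {n t} → t ≤ 2 → n + t < suc (n + 2)
tail<cols {n} t≤2 = s≤s (+-monoʳ-≤ n t≤2)

Mthm-parts : ∀ n {r c ρ γ} (r< : r < n + 2) (c< : c < suc (n + 2)) →
  rowPart n r ≡ ρ → colPart n c ≡ γ → Mthm n (fromℕ< r<) (fromℕ< c<) ≡ entryᵖ ρ γ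
Mthm-parts n r< c< refl refl =
  trans (cong₂ (entry n) (toℕ-fromℕ< r<) (toℕ-fromℕ< c<)) (entry-parts n _ _)

Mthm-rank≥ : ∀ {n d} → 2 ≤ n → BinFactorization (Mthm n) d → suc (suc n) ≤ d
Mthm-rank≥ {n} (s≤s (s≤s _)) F = rank≥ F (λ ()) (escape zero z≤n) (escape (suc zero) ≤-refl)
  where
  row : Fin n → Fin (n + 2)
  row j = fromℕ< (low<rows (toℕ<n j))

  col : Fin n → Fin (suc (n + 2))
  col j = fromℕ< (low<cols (toℕ<n j))

  midRow topRow : Fin (n + 2)
  midRow = fromℕ< (mid<rows n)
  topRow = fromℕ< (top<rows n)

  tailCol : ∀ t → t ≤ 2 → Fin (suc (n + 2))
  tailCol t t≤2 = fromℕ< (tail<cols {n} t≤2)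

  row-at : ∀ j {c γ} (c< : c < suc (n + 2)) → colPart n c ≡ γ →
    Mthm n (row j) (fromℕ< c<) ≡ entryᵖ (low (toℕ j)) γ
  row-at j c< = Mthm-parts n (low<rows (toℕ<n j)) c< (rowPart-low (toℕ<n j))

  diag-one : ∀ j → Mthm n (row j) (col j) ≡ true
  diag-one j = trans (row-at j (low<cols (toℕ<n j)) (colPart-low (toℕ<n j))) (≡ᵇ-refl (toℕ j))

  diag-zero : ∀ {j j′} → j ≢ j′ → Mthm n (row j) (col j′) ≡ false
  diag-zero {j} {j′} j≢j′ =
    trans (row-at j (low<cols (toℕ<n j′)) (colPart-low (toℕ<n j′))) (≡ᵇ-false (j≢j′ ∘ toℕ-injective))

  mid-zero : ∀ j → Mthm n midRow (col j) ≡ false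
  mid-zero j = Mthm-parts n (mid<rows n) (low<cols (toℕ<n j)) (rowPart-mid n) (colPart-low (toℕ<n j))

  top-one : ∀ j → Mthm n topRow (col j) ≡ true
  top-one j = Mthm-parts n (top<rows n) (low<cols (toℕ<n j)) (rowPart-top n) (colPart-low (toℕ<n j))

  open RankLowerBound (Mthm n) row col midRow topRow (tailCol 2 ≤-refl) diag-one diag-zero mid-zero top-one

  escape : ∀ j → toℕ j ≤ 1 → Escape j
  escape j j≤1 = record
    { θ     = tailCol (toℕ j) j≤2
    ; mid-θ = Mthm-parts n (mid<rows n) (tail<cols j≤2) (rowPart-mid n) (colPart-tail n (toℕ j))
    ; row-θ = trans (row-at j (tail<cols j≤2) (colPart-tail n (toℕ j))) (cong not (≡ᵇ-refl (toℕ j)))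
    ; row-σ = trans (row-at j (tail<cols {n} ≤-refl) (colPart-tail n 2)) (cong not (≡ᵇ-false 2≢j))
    }
    where
    j≤2 = m≤n⇒m≤1+n j≤1
    2≢j : 2 ≢ toℕ j
    2≢j 2≡j with s≤s () ← subst (_≤ 1) (sym 2≡j) j≤1

next : Fin 3 → Fin 3
next 0F = 1F
next 1F = 2F
next 2F = 0F

owner : Fin 3 → ℕ → Fin 3
owner a t = if t ≡ᵇ toℕ (next (next a)) then next a else next (next a)

inX inY : Fin 3 → ℕ → Bool
inX a r = not ((r ≡ᵇ toℕ a) ∨ (r ≡ᵇ toℕ (next (next a))))
inY a r = not ((r ≡ᵇ toℕ (next a)) ∨ (r ≡ᵇ toℕ (next (next a))))

-- Rectangles are indexed like rows: low k is the rectangle through (k, k), while mid and top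
-- are X and Y.
Aᵖ : Fin 3 → RowPart → RowPart → Bool
Aᵖ a (low r) (low k) = r ≡ᵇ k
Aᵖ a mid     (low k) = false
Aᵖ a top     (low k) = true
Aᵖ a (low r) mid     = inX a r
Aᵖ a (low r) top     = inY a r
Aᵖ a mid     mid     = true
Aᵖ a mid     top     = true
Aᵖ a top     mid     = false
Aᵖ a top     top     = false

Bᵖ : Fin 3 → RowPart → ColPart → Bool
Bᵖ a (low k) (low c)  = k ≡ᵇ c
Bᵖ a (low k) (tail t) = k ≡ᵇ toℕ (owner a t)
Bᵖ a mid     (low _)  = false
Bᵖ a mid     (tail t) = t ≡ᵇ toℕ a
Bᵖ a top     (low _)  = false
Bᵖ a top     (tail t) = not (t ≡ᵇ toℕ a)

LowTail : Fin 3 → ℕ → ℕ → Set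
LowTail a t r = val (not (t ≡ᵇ r))
  ≡ val (r ≡ᵇ toℕ (owner a t)) + val (inX a r) * val (t ≡ᵇ toℕ a) + val (inY a r) * val (not (t ≡ᵇ toℕ a))

lowTail? : ∀ a r → Dec (∀ (t : Fin 3) → LowTail a (toℕ t) r)
lowTail? a r = all? λ t → _ ≟ _

lowTail : ∀ a {t} r → t < 3 → LowTail a t r
lowTail a {t} r t<3 = subst (λ t → LowTail a t r) (toℕ-fromℕ< t<3) (check a (fromℕ< t<3) r)
  where
  -- For r ≥ 3 every comparison involving r is with a number below 3, so one check covers them.
  check : ∀ a (t : Fin 3) r → LowTail a (toℕ t) r
  check a t 0 = from-yes (all? λ a → lowTail? a 0) a t
  check a t 1 = from-yes (all? λ a → lowTail? a 1) a t
  check a t 2 = from-yes (all? λ a → lowTail? a 2) a t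
  check a t (suc (suc (suc k))) = from-yes (all? λ a → lowTail? a (3 + k)) a t

module _ (a : Fin 3) {n : ℕ} (n≥3 : 3 ≤ n) where

  hits : RowPart → ColPart → RowPart → ℕ
  hits ρ γ κ = val (Aᵖ a ρ κ) * val (Bᵖ a κ γ)

  sum-hits≡entry : ∀ {ρ γ} → RowView n ρ → ColView n γ →
    sumTo n (hits ρ γ ∘ low) + hits ρ γ mid + hits ρ γ top ≡ val (entryᵖ ρ γ)
  sum-hits≡entry (low {r} r<n) (low {c} c<n) =
    trans (cong₂ _+_ (cong₂ _+_ (sumTo-δˡ (λ k → val (k ≡ᵇ c)) r<n) (*-zeroʳ (val (inX a r))))
                     (*-zeroʳ (val (inY a r))))
          (trans (+-identityʳ _) (+-identityʳ _))
  sum-hits≡entry (low {r} r<n) (tail {t} t<3) =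
    trans (cong (λ s → s + _ + _) (sumTo-δˡ (λ k → val (k ≡ᵇ toℕ (owner a t))) r<n)) (sym (lowTail a r t<3))
  sum-hits≡entry mid (low c<n) = cong (λ s → s + 0 + 0) (sumTo-zero n (λ _ → refl))
  sum-hits≡entry mid (tail {t} t<3) =
    trans (cong₂ _+_ (cong₂ _+_ (sumTo-zero n (λ _ → refl)) (*-identityˡ _)) (*-identityˡ _))
          (val+val-not (t ≡ᵇ toℕ a))
  sum-hits≡entry top (low {c} c<n) = trans (trans (+-identityʳ _) (+-identityʳ _)) (sumTo-δʳ (λ _ → 1) c<n)
  sum-hits≡entry top (tail {t} t<3) =
    trans (trans (+-identityʳ _) (+-identityʳ _))
          (sumTo-δʳ (λ _ → 1) (<-≤-trans (toℕ<n (owner a t)) n≥3))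

  factorization : BinFactorization (Mthm n) (suc (suc n))
  factorization = A , B , M≡AB
    where
    A : Mat01 (n + 2) (suc (suc n))
    A i k = Aᵖ a (rowPart n (toℕ i)) (rowPart n (toℕ k))
    B : Mat01 (suc (suc n)) (suc (n + 2))
    B k j = Bᵖ a (rowPart n (toℕ k)) (colPart n (toℕ j))
    M≡AB : ∀ i j → val (Mthm n i j) ≡ sumFin (suc (suc n)) (λ k → val (A i k) * val (B k j))
    M≡AB i j = begin
      val (Mthm n i j)
        ≡⟨ cong val (entry-parts n (toℕ i) (toℕ j)) ⟩
      val (entryᵖ ρ γ)
        ≡⟨ sum-hits≡entry (rowView (toℕ<n i)) (colView (toℕ<n j)) ⟨
      sumTo n (hits ρ γ ∘ low) + hits ρ γ mid + hits ρ γ top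
        ≡⟨ sumTo-rowParts n (hits ρ γ) ⟨
      sumTo (suc (suc n)) (hits ρ γ ∘ rowPart n)
        ≡⟨ sumFin-toℕ (suc (suc n)) (hits ρ γ ∘ rowPart n) ⟨
      sumFin (suc (suc n)) (λ k → val (A i k) * val (B k j))
        ∎
      where
      open ≡-Reasoning
      ρ = rowPart n (toℕ i)
      γ = colPart n (toℕ j)

owner-≢ : ∀ a t → owner a t ≢ a
owner-≢ a t with t ≡ᵇ toℕ (next (next a))
owner-≢ 0F t | true  = λ ()
owner-≢ 1F t | true  = λ ()
owner-≢ 2F t | true  = λ ()
owner-≢ 0F t | false = λ ()
owner-≢ 1F t | false = λ ()
owner-≢ 2F t | false = λ ()

avoiding : ℕ → Fin 3
avoiding 1 = 1F
avoiding 2 = 2F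
avoiding _ = 0F

owner-avoids : ∀ j t → j ≢ toℕ (owner (avoiding j) t)
owner-avoids 0 t j≡o = owner-≢ 0F t (toℕ-injective (sym j≡o))
owner-avoids 1 t j≡o = owner-≢ 1F t (toℕ-injective (sym j≡o))
owner-avoids 2 t j≡o = owner-≢ 2F t (toℕ-injective (sym j≡o))
owner-avoids (suc (suc (suc k))) t j≡o
  with s≤s (s≤s (s≤s ())) ← subst (_< 3) (sym j≡o) (toℕ<n (owner 0F t))

low-rectangle-only : ∀ j γ → γ ≢ low j → Bᵖ (avoiding j) (low j) γ ≡ false
low-rectangle-only j (low c)  c≢j = ≡ᵇ-false (c≢j ∘ cong low ∘ sym)
low-rectangle-only j (tail t) _   = ≡ᵇ-false (owner-avoids j t)

mid-rectangle-only : ∀ {a t} → toℕ a ≡ t → ∀ γ → γ ≢ tail t → Bᵖ a mid γ ≡ false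
mid-rectangle-only a≡t (low _)   _    = refl
mid-rectangle-only a≡t (tail t′) t′≢t = ≡ᵇ-false (λ t′≡a → t′≢t (cong tail (trans t′≡a a≡t)))

module _ {n} (n≥3 : 3 ≤ n) (c : Fin (suc (n + 2))) where

  drop-rectangle : ∀ a {k κ γ₀} → k < suc (suc n) → rowPart n k ≡ κ → colPart n (toℕ c) ≡ γ₀ →
    (∀ γ → γ ≢ γ₀ → Bᵖ a κ γ ≡ false) → BinFactorization (deleteCol (Mthm n) c) (suc n)
  drop-rectangle a k< k-part c-part κ⊆γ₀ =
    deleteCol-factorization (factorization a n≥3) (fromℕ< k<) λ j j≢c →
      trans (cong (λ k → Bᵖ a (rowPart n k) (colPart n (toℕ j))) (toℕ-fromℕ< k<))
            (trans (cong (λ κ → Bᵖ a κ (colPart n (toℕ j))) k-part)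
                   (κ⊆γ₀ _ (λ j≡γ₀ → j≢c (toℕ-injective (colPart-injective {n} (trans j≡γ₀ (sym c-part)))))))

  deleteCol-Mthm : BinFactorization (deleteCol (Mthm n) c) (suc n)
  deleteCol-Mthm with colPart n (toℕ c) in c-part | colView {n} (toℕ<n c)
  ... | low j  | low j<n  = drop-rectangle (avoiding j) (m≤n⇒m≤o+n 2 j<n) (rowPart-low j<n) c-part
                                           (low-rectangle-only j)
  ... | tail t | tail t<3 = drop-rectangle (fromℕ< t<3) (n≤1+n (suc n)) (rowPart-mid n) c-part
                                           (mid-rectangle-only (toℕ-fromℕ< t<3))

mainTheorem11 : (n : ℕ) → 3 ≤ n →
    IsBinRank (Mthm n) (n + 2)
      × ((c : Fin (suc (n + 2))) → BinRankAtMost (deleteCol (Mthm n) c) (n + 1))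
mainTheorem11 n n≥3 =
  ( subst (BinFactorization (Mthm n)) (+-comm 2 n) (factorization 0F n≥3)
  , λ d F → subst (_≤ d) (+-comm 2 n) (Mthm-rank≥ (≤-trans (n≤1+n 2) n≥3) F) )
  , λ c → suc n , ≤-reflexive (+-comm 1 n) , deleteCol-Mthm n≥3 c
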